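{- Let $t\mid\phi$ and $t'\mid\phi'$ be constrained terms. Then $\llbracket t\mid\phi\rrbracket\subseteq_{\mathit{shared}}\llbracket t'\mid\phi'\rrbracket$ holds if and only if $M^\Sigma\models\phi\to(\exists\tilde x)(t=t'\wedge\phi')$, where $\tilde x=\mathit{var}(t',\phi')\setminus\mathit{var}(t,\phi)$.
   Context: Fix a many-sorted builtin signature $\Sigma^b$ (with sort $\mathit{Bool}$) and builtin model $M^b$ ($M^b_{\mathit{Bool}}=\{\top,\bot\}$). A signature modulo builtins is a preregular order-sorted signature $\Sigma=(S,\le,F)$ containing $\Sigma^b$ whose constants of each builtin sort $s$ are exactly the elements of $M^b_s$. $M^\Sigma$ is the $\Sigma$-model with builtin carriers and functions as in $M^b$, carriers of non-builtin sorts being the ground terms built from non-builtin symbols and builtin constants, and non-builtin symbols interpreted as term constructors; all carriers nonempty. Constraint formulas are first-order formulas with equality over $\Sigma$, interpreted in $M^\Sigma$. A constrained term $t\mid\phi$ is a term $t$ with variables plus a constraint formula $\phi$; $\mathit{var}(t,\phi)$ is the set of variables of $t$ and free variables of $\phi$; $\llbracket t\mid\phi\rrbracket=\{\alpha(t)\mid\alpha:\mathcal{X}\to M^\Sigma,\ M^\Sigma,\alpha\models\phi\}$. Since carriers consist of ground terms, a map $\sigma$ from variables to $M^\Sigma$ is also a substitution. $\llbracket\varphi\rrbracket\subseteq_{\mathit{shared}}\llbracket\varphi'\rrbracket$ means: for every $\sigma:\mathit{var}(\varphi)\cap\mathit{var}(\varphi')\to M^\Sigma$, $\llbracket\sigma(\varphi)\rrbracket\subseteq\llbracket\sigma(\varphi')\rrbracket$.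 -}

module Defs where

open import Data.Bool using () renaming (Bool to 𝔹)
open import Data.List using (List; []; _∷_; map; _++_; filter; foldr)
open import Data.List.Relation.Unary.All using (All; []; _∷_)
open import Data.List.Relation.Binary.Pointwise using (Pointwise)
open import Data.List.Membership.Propositional using (_∈_)
import Data.List.Membership.DecPropositional as DecMem
open import Data.Maybe using (Maybe; just; nothing)
open import Data.Product using (Σ; _×_; _,_; proj₁; proj₂)
open import Data.Sum using (_⊎_; inj₁; inj₂)
open import Data.Empty using (⊥)
open import Data.Unit using (⊤)
open import Function.Bundles using (_↔_)
open import Relation.Binary.PropositionalEquality using (_≡_; refl; subst)
open import Relation.Binary.Definitions using (DecidableEquality)
open import Relation.Binary.Structures using (IsPartialOrder)
open import Relation.Nullary using (yes; no; ¬?)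

-- The builtin *constants* of sort b are exactly the elements of Mᵇ_b
-- (they are represented directly by the values, see `con` below);
-- `BOp ws b` are the remaining (non-constant) builtin operation symbols.

record BuiltinSignature : Set₁ where
  field
    BSort   : Set
    Boolᵇ   : BSort
    BOp     : List BSort → BSort → Set
    BOp-nonconst : ∀ {b} → BOp [] b → ⊥

record BuiltinModel (Σb : BuiltinSignature) : Set₁ where
  open BuiltinSignature Σb
  field
    Val      : BSort → Set
    Val-Bool : Val Boolᵇ ↔ 𝔹
    ⟦_⟧ᵒ     : ∀ {ws b} → BOp ws b → All Val ws → Val b

-- Builtin sorts are
-- only related to themselves or below user sorts; user symbols have
-- user result sorts.

record Signature (Σb : BuiltinSignature) : Set₁ where
  open BuiltinSignature Σb
  field
    USort      : Set
    _≤ᵘ_       : USort → USort → Set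
    ≤ᵘ-po      : IsPartialOrder _≡_ _≤ᵘ_
    _≤ᵇᵘ_      : BSort → USort → Set
    ≤ᵇᵘ-trans  : ∀ {b u u'} → b ≤ᵇᵘ u → u ≤ᵘ u' → b ≤ᵇᵘ u'
    Sym        : Set
    Rank       : Sym → List (BSort ⊎ USort) → USort → Set

module Sorts {Σb : BuiltinSignature} (S : Signature Σb) where
  open BuiltinSignature Σb
  open Signature S

  Sort : Set
  Sort = BSort ⊎ USort

  data _≤_ : Sort → Sort → Set where
    b≤b : ∀ {b} → inj₁ b ≤ inj₁ b
    b≤u : ∀ {b u} → b ≤ᵇᵘ u → inj₁ b ≤ inj₂ u
    u≤u : ∀ {u u'} → u ≤ᵘ u' → inj₂ u ≤ inj₂ u'

  ≤-trans : ∀ {s₁ s₂ s₃} → s₁ ≤ s₂ → s₂ ≤ s₃ → s₁ ≤ s₃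
  ≤-trans b≤b q = q
  ≤-trans (b≤u p) (u≤u q) = b≤u (≤ᵇᵘ-trans p q)
  ≤-trans (u≤u p) (u≤u q) = u≤u (IsPartialOrder.trans ≤ᵘ-po p q)

  _≤*_ : List Sort → List Sort → Set
  _≤*_ = Pointwise _≤_

-- Preregularity: for each symbol f and arity w₀, the set of result sorts
-- {u | f ∈ F_{w,u}, w₀ ≤ w} has a least element whenever it is nonempty.
-- (Builtin operations are many-sorted with a unique rank, hence trivially
-- preregular.)
Preregular : {Σb : BuiltinSignature} → Signature Σb → Set
Preregular S =
  ∀ (f : Sym) (w₀ : List Sort) {w u} → Rank f w u → w₀ ≤* w →
  Σ USort λ u₀ → (Σ (List Sort) λ w' → Rank f w' u₀ × w₀ ≤* w')
               × (∀ {w' u'} → Rank f w' u' → w₀ ≤* w' → u₀ ≤ᵘ u')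
  where open Signature S; open Sorts S

-- The model M^Σ: carrier elements are ground terms built from
-- non-builtin symbols and builtin constants (the builtin values).

module Ground {Σb : BuiltinSignature} (Mb : BuiltinModel Σb) (S : Signature Σb) where
  open BuiltinSignature Σb
  open BuiltinModel Mb
  open Signature S
  open Sorts S

  data G : Set where
    gcon : (b : BSort) → Val b → G
    gapp : Sym → List G → G

  mutual
    data _∶_ : G → Sort → Set where
      gcon : ∀ {b v s} → inj₁ b ≤ s → gcon b v ∶ s
      gapp : ∀ {f gs w u s} → Rank f w u → gs ∶* w → inj₂ u ≤ s → gapp f gs ∶ s

    data _∶*_ : List G → List Sort → Set where
      []  : [] ∶* []
      _∷_ : ∀ {g gs s w} → g ∶ s → gs ∶* w → (g ∷ gs) ∶* (s ∷ w)

  Carrier : Sort → Set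
  Carrier s = Σ G (_∶ s)

  ∶-≤ : ∀ {g s s'} → g ∶ s → s ≤ s' → g ∶ s'
  ∶-≤ (gcon p) q = gcon (≤-trans p q)
  ∶-≤ (gapp r ds p) q = gapp r ds (≤-trans p q)

  valOf : ∀ {g b} → g ∶ inj₁ b → Val b
  valOf (gcon {v = v} b≤b) = v

record IsSignatureModuloBuiltins {Σb : BuiltinSignature} (Mb : BuiltinModel Σb)
                                 (S : Signature Σb) : Set where
  open Sorts S
  open Ground Mb S
  field
    preregular : Preregular S
    nonempty   : ∀ (s : Sort) → Carrier s

record Variables {Σb : BuiltinSignature} (S : Signature Σb) : Set₁ where
  open Sorts S
  field
    Var    : Set
    sortOf : Var → Sort
    _≟_    : DecidableEquality Var

module Semantics {Σb : BuiltinSignature} (Mb : BuiltinModel Σb) (S : Signature Σb)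
                 (X : Variables S) where
  open BuiltinSignature Σb
  open BuiltinModel Mb
  open Signature S
  open Sorts S
  open Ground Mb S
  open Variables X
  open DecMem _≟_ using (_∈?_)

  mutual
    data Term : Sort → Set where
      var : ∀ {s} (x : Var) → sortOf x ≤ s → Term s
      con : ∀ {b s} → Val b → inj₁ b ≤ s → Term s
      bop : ∀ {ws b s} → BOp ws b → Terms (map inj₁ ws) → inj₁ b ≤ s → Term s
      app : ∀ {w u s} (f : Sym) → Rank f w u → Terms w → inj₂ u ≤ s → Term s

    data Terms : List Sort → Set where
      []  : Terms []
      _∷_ : ∀ {s w} → Term s → Terms w → Terms (s ∷ w)

  infix  7 _≐_
  infixr 6 _∧ᶠ_
  infixr 5 _∨ᶠ_
  infixr 4 _⇒ᶠ_

  data Formula : Set where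
    ⊤ᶠ ⊥ᶠ : Formula
    _≐_   : ∀ {s s'} → Term s → Term s' → Formula
    ¬ᶠ_   : Formula → Formula
    _∧ᶠ_ _∨ᶠ_ _⇒ᶠ_ : Formula → Formula → Formula
    ∀ᶠ ∃ᶠ : Var → Formula → Formula

  Assignment : Set
  Assignment = (x : Var) → Carrier (sortOf x)

  _[_↦_] : Assignment → (x : Var) → Carrier (sortOf x) → Assignment
  (α [ x ↦ c ]) y with x ≟ y
  ... | yes p = subst (λ z → Carrier (sortOf z)) p c
  ... | no _  = α y

  mutual
    eval : ∀ {s} → Assignment → Term s → Carrier s
    eval α (var x p)     = proj₁ (α x) , ∶-≤ (proj₂ (α x)) p
    eval α (con {b} v p) = gcon b v , gcon p
    eval α (bop {ws} {b} o ts p) = gcon b (⟦ o ⟧ᵒ (evalsB α ws ts)) , gcon p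
    eval α (app f r ts p) with evals α ts
    ... | gs , ds = gapp f gs , gapp r ds p

    evals : ∀ {w} → Assignment → Terms w → Σ (List G) (_∶* w)
    evals α [] = [] , []
    evals α (t ∷ ts) with eval α t | evals α ts
    ... | g , d | gs , ds = g ∷ gs , d ∷ ds

    evalsB : Assignment → (ws : List BSort) → Terms (map inj₁ ws) → All Val ws
    evalsB α [] [] = []
    evalsB α (b ∷ ws) (t ∷ ts) = valOf (proj₂ (eval α t)) ∷ evalsB α ws ts

  _⊨_ : Assignment → Formula → Set
  α ⊨ ⊤ᶠ = ⊤
  α ⊨ ⊥ᶠ = ⊥
  α ⊨ (t ≐ t') = proj₁ (eval α t) ≡ proj₁ (eval α t')
  α ⊨ (¬ᶠ φ) = α ⊨ φ → ⊥
  α ⊨ (φ ∧ᶠ ψ) = α ⊨ φ × α ⊨ ψ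
  α ⊨ (φ ∨ᶠ ψ) = α ⊨ φ ⊎ α ⊨ ψ
  α ⊨ (φ ⇒ᶠ ψ) = α ⊨ φ → α ⊨ ψ
  α ⊨ ∀ᶠ x φ = (c : Carrier (sortOf x)) → (α [ x ↦ c ]) ⊨ φ
  α ⊨ ∃ᶠ x φ = Σ (Carrier (sortOf x)) λ c → (α [ x ↦ c ]) ⊨ φ

  Valid : Formula → Set
  Valid φ = (α : Assignment) → α ⊨ φ

  ∃⃗ : List Var → Formula → Formula
  ∃⃗ xs φ = foldr ∃ᶠ φ xs

  mutual
    varsT : ∀ {s} → Term s → List Var
    varsT (var x _) = x ∷ []
    varsT (con _ _) = []
    varsT (bop _ ts _) = varsTs ts
    varsT (app _ _ ts _) = varsTs ts

    varsTs : ∀ {w} → Terms w → List Var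
    varsTs [] = []
    varsTs (t ∷ ts) = varsT t ++ varsTs ts

  fv : Formula → List Var
  fv ⊤ᶠ = []
  fv ⊥ᶠ = []
  fv (t ≐ t') = varsT t ++ varsT t'
  fv (¬ᶠ φ) = fv φ
  fv (φ ∧ᶠ ψ) = fv φ ++ fv ψ
  fv (φ ∨ᶠ ψ) = fv φ ++ fv ψ
  fv (φ ⇒ᶠ ψ) = fv φ ++ fv ψ
  fv (∀ᶠ x φ) = filter (λ y → ¬? (x ≟ y)) (fv φ)
  fv (∃ᶠ x φ) = filter (λ y → ¬? (x ≟ y)) (fv φ)

  -- substitution of ground values (elements of M^Σ) for variables;
  -- ground, hence no variable capture.
  PSubst : Set
  PSubst = (x : Var) → Maybe (Carrier (sortOf x))

  mutual
    toTerm : ∀ {s} (g : G) → g ∶ s → Term s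
    toTerm (gcon b v) (gcon p) = con v p
    toTerm (gapp f gs) (gapp r ds p) = app f r (toTerms gs ds) p

    toTerms : ∀ {w} (gs : List G) → gs ∶* w → Terms w
    toTerms [] [] = []
    toTerms (g ∷ gs) (d ∷ ds) = toTerm g d ∷ toTerms gs ds

  mutual
    substT : ∀ {s} → PSubst → Term s → Term s
    substT ρ (var x p) with ρ x
    ... | just (g , d) = toTerm g (∶-≤ d p)
    ... | nothing      = var x p
    substT ρ (con v p) = con v p
    substT ρ (bop o ts p) = bop o (substTs ρ ts) p
    substT ρ (app f r ts p) = app f r (substTs ρ ts) p

    substTs : ∀ {w} → PSubst → Terms w → Terms w
    substTs ρ [] = []
    substTs ρ (t ∷ ts) = substT ρ t ∷ substTs ρ ts

  without : PSubst → Var → PSubst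
  without ρ x y with x ≟ y
  ... | yes _ = nothing
  ... | no _  = ρ y

  substF : PSubst → Formula → Formula
  substF ρ ⊤ᶠ = ⊤ᶠ
  substF ρ ⊥ᶠ = ⊥ᶠ
  substF ρ (t ≐ t') = substT ρ t ≐ substT ρ t'
  substF ρ (¬ᶠ φ) = ¬ᶠ substF ρ φ
  substF ρ (φ ∧ᶠ ψ) = substF ρ φ ∧ᶠ substF ρ ψ
  substF ρ (φ ∨ᶠ ψ) = substF ρ φ ∨ᶠ substF ρ ψ
  substF ρ (φ ⇒ᶠ ψ) = substF ρ φ ⇒ᶠ substF ρ ψ
  substF ρ (∀ᶠ x φ) = ∀ᶠ x (substF (without ρ x) φ)
  substF ρ (∃ᶠ x φ) = ∃ᶠ x (substF (without ρ x) φ)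

  infix 3 _∣_
  record CTerm : Set where
    constructor _∣_
    field
      {sort}     : Sort
      term       : Term sort
      constraint : Formula

  vars : CTerm → List Var
  vars (t ∣ φ) = varsT t ++ fv φ

  ⟦_⟧ : CTerm → G → Set
  ⟦ t ∣ φ ⟧ g = Σ Assignment λ α → α ⊨ φ × proj₁ (eval α t) ≡ g

  shared : CTerm → CTerm → List Var
  shared c c' = filter (λ x → x ∈? vars c') (vars c)

  Valuation : List Var → Set
  Valuation D = (x : Var) → x ∈ D → Carrier (sortOf x)

  asSubst : ∀ {D} → Valuation D → PSubst
  asSubst {D} σ x with x ∈? D
  ... | yes p = just (σ x p)
  ... | no _  = nothing

  _·_ : ∀ {D} → Valuation D → CTerm → CTerm
  σ · (t ∣ φ) = substT (asSubst σ) t ∣ substF (asSubst σ) φ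

  _⊆shared_ : CTerm → CTerm → Set
  c ⊆shared c' = (σ : Valuation (shared c c')) → ∀ g → ⟦ σ · c ⟧ g → ⟦ σ · c' ⟧ g

  x̃ : CTerm → CTerm → List Var
  x̃ c c' = filter (λ x → ¬? (x ∈? vars c)) (vars c')

-- An assignment α and a valuation σ of the shared variables combine into α ◃ σ (σ where defined,
-- α elsewhere), and the substitution lemma  α ⊨ σ φ  ⇔  α ◃ σ ⊨ φ  turns ⟦σ · (t ∣ φ)⟧ into the
-- values of t under the models of φ that extend σ. Forward: for α ⊨ φ take σ = α on the shared
-- variables; inclusion yields γ with γ(σ φ') and γ(σ t') = α(σ t), and α patched by γ ◃ σ on x̃
-- witnesses the existential, since x̃ is disjoint from var(t, φ) while var(t', φ') ∖ x̃ is shared.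
-- Backward: the existential at α ◃ σ gives β ⊨ t ≐ t' ∧ φ' that agrees with α ◃ σ outside x̃,
-- in particular on the shared variables, so β ◃ σ coincides with β and β witnesses the inclusion.
module Submission where

open import Defs
open import Data.Empty using (⊥-elim)
open import Data.List using (List; []; _∷_; filter; map)
open import Data.List.Membership.Propositional using (_∈_; _∉_)
open import Data.List.Membership.Propositional.Properties using (∈-++⁺ˡ; ∈-++⁺ʳ; ∈-filter⁺; ∈-filter⁻)
open import Data.List.Relation.Unary.Any using (here; there)
import Data.List.Membership.DecPropositional as DecMembership
open import Data.Maybe using (just; nothing)
open import Data.Product using (Σ; _×_; _,_; proj₁; proj₂)
open import Data.Product.Function.Dependent.Propositional using (Σ-⇔)
open import Data.Product.Function.NonDependent.Propositional using (_×-⇔_)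
open import Data.Sum using (inj₁)
open import Data.Sum.Function.Propositional using (_⊎-⇔_)
open import Function using (_∘_)
open import Function.Bundles using (_⇔_; mk⇔; module Equivalence)
open import Function.Construct.Identity using (⇔-id; ↠-id)
open import Function.Construct.Composition using (_⇔-∘_)
open import Function.Related.TypeIsomorphisms using (→-cong-⇔; ¬-cong-⇔)
open import Relation.Binary.PropositionalEquality using (_≡_; _≢_; refl; sym; trans; cong; module ≡-Reasoning)
open import Relation.Nullary using (yes; no; ¬?)

open Equivalence using (to; from)

∀-cong-⇔ : {A : Set} {B C : A → Set} → (∀ a → B a ⇔ C a) → ((a : A) → B a) ⇔ ((a : A) → C a)
∀-cong-⇔ B⇔C = mk⇔ (λ f a → to (B⇔C a) (f a)) (λ g a → from (B⇔C a) (g a))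

module SemanticsProperties (Σb : BuiltinSignature) (Mb : BuiltinModel Σb)
                           (S : Signature Σb) (X : Variables S) where
  open Ground Mb S
  open Variables X
  open Semantics Mb S X
  open DecMembership _≟_ using (_∈?_)

  EqualOn : List Var → Assignment → Assignment → Set
  EqualOn V α β = ∀ {x} → x ∈ V → α x ≡ β x

  EqualOutside : List Var → Assignment → Assignment → Set
  EqualOutside V α β = ∀ {x} → x ∉ V → α x ≡ β x

  mutual
    eval-agree : ∀ α β {s} (t : Term s) → EqualOn (varsT t) α β → eval α t ≡ eval β t
    eval-agree α β (var x _) h rewrite h (here refl) = refl
    eval-agree α β (con _ _) h = refl
    eval-agree α β (bop {ws} _ ts _) h rewrite evalsB-agree α β ws ts h = refl
    eval-agree α β (app _ _ ts _) h rewrite evals-agree α β ts h = refl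

    evals-agree : ∀ α β {w} (ts : Terms w) → EqualOn (varsTs ts) α β → evals α ts ≡ evals β ts
    evals-agree α β [] h = refl
    evals-agree α β (t ∷ ts) h
      rewrite eval-agree α β t (h ∘ ∈-++⁺ˡ) | evals-agree α β ts (h ∘ ∈-++⁺ʳ (varsT t)) = refl

    evalsB-agree : ∀ α β ws (ts : Terms (map inj₁ ws)) → EqualOn (varsTs ts) α β →
                   evalsB α ws ts ≡ evalsB β ws ts
    evalsB-agree α β [] [] h = refl
    evalsB-agree α β (_ ∷ ws) (t ∷ ts) h
      rewrite eval-agree α β t (h ∘ ∈-++⁺ˡ) | evalsB-agree α β ws ts (h ∘ ∈-++⁺ʳ (varsT t)) = refl

  EqualOn-[↦] : ∀ α β x c V → EqualOn (filter (λ y → ¬? (x ≟ y)) V) α β →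
                EqualOn V (α [ x ↦ c ]) (β [ x ↦ c ])
  EqualOn-[↦] α β x c V h {y} y∈V with x ≟ y
  ... | yes refl = refl
  ... | no x≢y = h (∈-filter⁺ (λ y → ¬? (x ≟ y)) y∈V x≢y)

  ⊨-agree : ∀ α β φ → EqualOn (fv φ) α β → α ⊨ φ ⇔ β ⊨ φ
  ⊨-agree α β ⊤ᶠ h = ⇔-id _
  ⊨-agree α β ⊥ᶠ h = ⇔-id _
  ⊨-agree α β (t ≐ t') h
    rewrite eval-agree α β t (h ∘ ∈-++⁺ˡ) | eval-agree α β t' (h ∘ ∈-++⁺ʳ (varsT t)) = ⇔-id _
  ⊨-agree α β (¬ᶠ φ) h = ¬-cong-⇔ (⊨-agree α β φ h)
  ⊨-agree α β (φ ∧ᶠ ψ) h = ⊨-agree α β φ (h ∘ ∈-++⁺ˡ) ×-⇔ ⊨-agree α β ψ (h ∘ ∈-++⁺ʳ (fv φ))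
  ⊨-agree α β (φ ∨ᶠ ψ) h = ⊨-agree α β φ (h ∘ ∈-++⁺ˡ) ⊎-⇔ ⊨-agree α β ψ (h ∘ ∈-++⁺ʳ (fv φ))
  ⊨-agree α β (φ ⇒ᶠ ψ) h = →-cong-⇔ (⊨-agree α β φ (h ∘ ∈-++⁺ˡ)) (⊨-agree α β ψ (h ∘ ∈-++⁺ʳ (fv φ)))
  ⊨-agree α β (∀ᶠ x φ) h = ∀-cong-⇔ λ c → ⊨-agree _ _ φ (EqualOn-[↦] α β x c (fv φ) h)
  ⊨-agree α β (∃ᶠ x φ) h = Σ-⇔ (↠-id _) (⊨-agree _ _ φ (EqualOn-[↦] α β x _ (fv φ) h))

  ⊨-ext : ∀ α β φ → (∀ x → α x ≡ β x) → α ⊨ φ ⇔ β ⊨ φ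
  ⊨-ext α β φ h = ⊨-agree α β φ (λ {x} _ → h x)

  _◃_ : Assignment → PSubst → Assignment
  (α ◃ ρ) x with ρ x
  ... | just c  = c
  ... | nothing = α x

  mutual
    eval-toTerm : ∀ α {s} (g : G) (d : g ∶ s) → eval α (toTerm g d) ≡ (g , d)
    eval-toTerm α (gcon _ _) (gcon _) = refl
    eval-toTerm α (gapp _ gs) (gapp _ ds _) rewrite evals-toTerms α gs ds = refl

    evals-toTerms : ∀ α {w} (gs : List G) (ds : gs ∶* w) → evals α (toTerms gs ds) ≡ (gs , ds)
    evals-toTerms α [] [] = refl
    evals-toTerms α (g ∷ gs) (d ∷ ds) rewrite eval-toTerm α g d | evals-toTerms α gs ds = refl

  mutual
    eval-substT : ∀ α ρ {s} (t : Term s) → eval α (substT ρ t) ≡ eval (α ◃ ρ) t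
    eval-substT α ρ (var x p) with ρ x
    ... | just (g , d) = eval-toTerm α g (∶-≤ d p)
    ... | nothing      = refl
    eval-substT α ρ (con _ _) = refl
    eval-substT α ρ (bop {ws} _ ts _) rewrite evalsB-substTs α ρ ws ts = refl
    eval-substT α ρ (app _ _ ts _) rewrite evals-substTs α ρ ts = refl

    evals-substTs : ∀ α ρ {w} (ts : Terms w) → evals α (substTs ρ ts) ≡ evals (α ◃ ρ) ts
    evals-substTs α ρ [] = refl
    evals-substTs α ρ (t ∷ ts) rewrite eval-substT α ρ t | evals-substTs α ρ ts = refl

    evalsB-substTs : ∀ α ρ ws (ts : Terms (map inj₁ ws)) →
                     evalsB α ws (substTs ρ ts) ≡ evalsB (α ◃ ρ) ws ts
    evalsB-substTs α ρ [] [] = refl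
    evalsB-substTs α ρ (_ ∷ ws) (t ∷ ts) rewrite eval-substT α ρ t | evalsB-substTs α ρ ws ts = refl

  [↦]-same : ∀ α x c → (α [ x ↦ c ]) x ≡ c
  [↦]-same α x c with x ≟ x
  ... | yes refl = refl
  ... | no x≢x = ⊥-elim (x≢x refl)

  [↦]-other : ∀ α {x y} c → x ≢ y → (α [ x ↦ c ]) y ≡ α y
  [↦]-other α {x} {y} c x≢y with x ≟ y
  ... | yes x≡y = ⊥-elim (x≢y x≡y)
  ... | no _    = refl

  ◃-without : ∀ α ρ x c y → ((α [ x ↦ c ]) ◃ without ρ x) y ≡ ((α ◃ ρ) [ x ↦ c ]) y
  ◃-without α ρ x c y with x ≟ y
  ... | yes refl = [↦]-same α x c
  ... | no x≢y with ρ y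
  ...   | just _  = refl
  ...   | nothing = [↦]-other α c x≢y

  mutual
    ⊨-substF : ∀ α ρ φ → α ⊨ substF ρ φ ⇔ (α ◃ ρ) ⊨ φ
    ⊨-substF α ρ ⊤ᶠ = ⇔-id _
    ⊨-substF α ρ ⊥ᶠ = ⇔-id _
    ⊨-substF α ρ (t ≐ t') rewrite eval-substT α ρ t | eval-substT α ρ t' = ⇔-id _
    ⊨-substF α ρ (¬ᶠ φ) = ¬-cong-⇔ (⊨-substF α ρ φ)
    ⊨-substF α ρ (φ ∧ᶠ ψ) = ⊨-substF α ρ φ ×-⇔ ⊨-substF α ρ ψ
    ⊨-substF α ρ (φ ∨ᶠ ψ) = ⊨-substF α ρ φ ⊎-⇔ ⊨-substF α ρ ψ
    ⊨-substF α ρ (φ ⇒ᶠ ψ) = →-cong-⇔ (⊨-substF α ρ φ) (⊨-substF α ρ ψ)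
    ⊨-substF α ρ (∀ᶠ x φ) = ∀-cong-⇔ λ c → ⊨-substF-under α ρ x c φ
    ⊨-substF α ρ (∃ᶠ x φ) = Σ-⇔ (↠-id _) (⊨-substF-under α ρ x _ φ)

    ⊨-substF-under : ∀ α ρ x c φ →
                     (α [ x ↦ c ]) ⊨ substF (without ρ x) φ ⇔ ((α ◃ ρ) [ x ↦ c ]) ⊨ φ
    ⊨-substF-under α ρ x c φ = ⊨-ext _ _ φ (◃-without α ρ x c) ⇔-∘ ⊨-substF (α [ x ↦ c ]) (without ρ x) φ

  ∃⃗-intro : ∀ xs ψ α β → EqualOutside xs β α → β ⊨ ψ → α ⊨ ∃⃗ xs ψ
  ∃⃗-intro []       ψ α β β≈α βψ = to (⊨-ext β α ψ λ _ → β≈α λ ()) βψ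
  ∃⃗-intro (x ∷ xs) ψ α β β≈α βψ = β x , ∃⃗-intro xs ψ (α [ x ↦ β x ]) β β≈α[x↦βx] βψ
    where
    β≈α[x↦βx] : EqualOutside xs β (α [ x ↦ β x ])
    β≈α[x↦βx] {y} y∉xs with x ≟ y
    ... | yes refl = refl
    ... | no x≢y   = β≈α λ { (here y≡x) → x≢y (sym y≡x) ; (there y∈xs) → y∉xs y∈xs }

  ∃⃗-elim : ∀ xs ψ α → α ⊨ ∃⃗ xs ψ → Σ Assignment λ β → EqualOutside xs β α × β ⊨ ψ
  ∃⃗-elim []       ψ α αψ = α , (λ _ → refl) , αψ
  ∃⃗-elim (x ∷ xs) ψ α (c , αψ) with ∃⃗-elim xs ψ (α [ x ↦ c ]) αψ
  ... | β , β≈α , βψ = β , (λ y∉ → trans (β≈α (y∉ ∘ there)) ([↦]-other α c (y∉ ∘ here ∘ sym))) , βψ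

  restrict : (D : List Var) → Assignment → Valuation D
  restrict D α x _ = α x

  ◃-restrict-∈ : ∀ α δ {D y} → y ∈ D → (α ◃ asSubst (restrict D δ)) y ≡ δ y
  ◃-restrict-∈ α δ {D} {y} y∈D with y ∈? D
  ... | yes _   = refl
  ... | no y∉D = ⊥-elim (y∉D y∈D)

  ◃-restrict-∉ : ∀ α δ {D y} → y ∉ D → (α ◃ asSubst (restrict D δ)) y ≡ α y
  ◃-restrict-∉ α δ {D} {y} y∉D with y ∈? D
  ... | yes y∈D = ⊥-elim (y∉D y∈D)
  ... | no _    = refl

  ◃-restrict-self : ∀ α D y → (α ◃ asSubst (restrict D α)) y ≡ α y
  ◃-restrict-self α D y with y ∈? D
  ... | yes _ = refl
  ... | no _  = refl

  ◃-absorb : ∀ {D} (σ : Valuation D) α β → EqualOn D β (α ◃ asSubst σ) →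
             ∀ y → (β ◃ asSubst σ) y ≡ β y
  ◃-absorb {D} σ α β β≈ y with y ∈? D | β≈ {y}
  ... | yes y∈D | β≈ʸ = sym (β≈ʸ y∈D)
  ... | no _    | _   = refl

  module _ (c c' : CTerm) where

    shared⊆vars : ∀ {y} → y ∈ shared c c' → y ∈ vars c
    shared⊆vars = proj₁ ∘ ∈-filter⁻ (_∈? vars c')

    ∈-shared : ∀ {y} → y ∈ vars c → y ∈ vars c' → y ∈ shared c c'
    ∈-shared = ∈-filter⁺ (_∈? vars c')

    x̃-fresh : ∀ {y} → y ∈ vars c → y ∉ x̃ c c'
    x̃-fresh y∈c y∈x̃ = proj₂ (∈-filter⁻ (¬? ∘ (_∈? vars c)) {xs = vars c'} y∈x̃) y∈c

    ∉x̃⇒∈vars : ∀ {y} → y ∈ vars c' → y ∉ x̃ c c' → y ∈ vars c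
    ∉x̃⇒∈vars {y} y∈c' y∉x̃ with y ∈? vars c
    ... | yes y∈c = y∈c
    ... | no y∉c  = ⊥-elim (y∉x̃ (∈-filter⁺ (¬? ∘ (_∈? vars c)) y∈c' y∉c))

  module _ {s s'} (t : Term s) (φ : Formula) (t' : Term s') (φ' : Formula) where
    open ≡-Reasoning

    private
      c c' : CTerm
      c  = t ∣ φ
      c' = t' ∣ φ'

    ⊆shared⇒valid : c ⊆shared c' → Valid (φ ⇒ᶠ ∃⃗ (x̃ c c') (t ≐ t' ∧ᶠ φ'))
    ⊆shared⇒valid c⊆c' α αφ = ∃⃗-intro xs _ α β (◃-restrict-∉ α δ) (βt≡βt' , βφ')
      where
      D xs : List Var
      D  = shared c c'
      xs = x̃ c c'
      ρ : PSubst
      ρ = asSubst (restrict D α)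
      αρ≈α : ∀ y → (α ◃ ρ) y ≡ α y
      αρ≈α = ◃-restrict-self α D
      αφρ : α ⊨ substF ρ φ
      αφρ = from (⊨-substF α ρ φ) (from (⊨-ext _ _ φ αρ≈α) αφ)
      match : ⟦ restrict D α · c' ⟧ (proj₁ (eval α (substT ρ t)))
      match = c⊆c' (restrict D α) (proj₁ (eval α (substT ρ t))) (α , αφρ , refl)
      γ : Assignment
      γ = proj₁ match
      δ β : Assignment
      δ = γ ◃ ρ
      β = α ◃ asSubst (restrict xs δ)
      β≈α : EqualOn (vars c) β α
      β≈α = ◃-restrict-∉ α δ ∘ x̃-fresh c c'
      β≈δ : EqualOn (vars c') β δ
      β≈δ {y} y∈c' with y ∈? xs
      ... | yes _   = refl
      ... | no y∉xs = sym (◃-restrict-∈ γ α (∈-shared c c' (∉x̃⇒∈vars c c' y∈c' y∉xs) y∈c'))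
      βφ' : β ⊨ φ'
      βφ' = from (⊨-agree β δ φ' (β≈δ ∘ ∈-++⁺ʳ (varsT t'))) (to (⊨-substF γ ρ φ') (proj₁ (proj₂ match)))
      βt≡βt' : proj₁ (eval β t) ≡ proj₁ (eval β t')
      βt≡βt' = begin
        proj₁ (eval β t)             ≡⟨ cong proj₁ (eval-agree β α t (β≈α ∘ ∈-++⁺ˡ)) ⟩
        proj₁ (eval α t)             ≡⟨ cong proj₁ (eval-agree α (α ◃ ρ) t λ {y} _ → sym (αρ≈α y)) ⟩
        proj₁ (eval (α ◃ ρ) t)       ≡⟨ cong proj₁ (eval-substT α ρ t) ⟨
        proj₁ (eval α (substT ρ t))  ≡⟨ proj₂ (proj₂ match) ⟨
        proj₁ (eval γ (substT ρ t')) ≡⟨ cong proj₁ (eval-substT γ ρ t') ⟩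
        proj₁ (eval δ t')            ≡⟨ cong proj₁ (eval-agree β δ t' (β≈δ ∘ ∈-++⁺ˡ)) ⟨
        proj₁ (eval β t')            ∎

    valid⇒⊆shared : Valid (φ ⇒ᶠ ∃⃗ (x̃ c c') (t ≐ t' ∧ᶠ φ')) → c ⊆shared c'
    valid⇒⊆shared valid σ g (α , αφρ , αtρ≡g)
      with ∃⃗-elim (x̃ c c') _ (α ◃ asSubst σ) (valid _ (to (⊨-substF α (asSubst σ) φ) αφρ))
    ... | β , β≈αρ , (βt≡βt' , βφ') = β , βφ'ρ , βt'ρ≡g
      where
      ρ : PSubst
      ρ = asSubst σ
      βρ≈β : ∀ y → (β ◃ ρ) y ≡ β y
      βρ≈β = ◃-absorb σ α β (β≈αρ ∘ x̃-fresh c c' ∘ shared⊆vars c c')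
      βφ'ρ : β ⊨ substF ρ φ'
      βφ'ρ = from (⊨-substF β ρ φ') (from (⊨-ext _ _ φ' βρ≈β) βφ')
      βt'ρ≡g : proj₁ (eval β (substT ρ t')) ≡ g
      βt'ρ≡g = begin
        proj₁ (eval β (substT ρ t')) ≡⟨ cong proj₁ (eval-substT β ρ t') ⟩
        proj₁ (eval (β ◃ ρ) t')      ≡⟨ cong proj₁ (eval-agree _ _ t' λ {y} _ → βρ≈β y) ⟩
        proj₁ (eval β t')            ≡⟨ βt≡βt' ⟨
        proj₁ (eval β t)             ≡⟨ cong proj₁ (eval-agree β (α ◃ ρ) t (β≈αρ ∘ x̃-fresh c c' ∘ ∈-++⁺ˡ)) ⟩
        proj₁ (eval (α ◃ ρ) t)       ≡⟨ cong proj₁ (eval-substT α ρ t) ⟨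
        proj₁ (eval α (substT ρ t))  ≡⟨ αtρ≡g ⟩
        g                            ∎

proposition2 : (Σb : BuiltinSignature) (Mb : BuiltinModel Σb) (S : Signature Σb)
               → IsSignatureModuloBuiltins Mb S → (X : Variables S)
               → let open Semantics Mb S X in
                 ∀ {s s'} (t : Term s) (φ : Formula) (t' : Term s') (φ' : Formula)
               → ((t ∣ φ) ⊆shared (t' ∣ φ'))
                 ⇔ Valid (φ ⇒ᶠ ∃⃗ (x̃ (t ∣ φ) (t' ∣ φ')) (t ≐ t' ∧ᶠ φ'))
proposition2 Σb Mb S _ X t φ t' φ' = mk⇔ (⊆shared⇒valid t φ t' φ') (valid⇒⊆shared t φ t' φ')
  where open SemanticsProperties Σb Mb S X
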